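{- Let $\mathcal{M}=(X,rk,m)$ be a multiplicity matroid whose underlying matroid $M=(X,rk)$ is loopless, and write $\mathfrak{M}_{\mathcal{M}}(x,y)=\sum_{i,j\ge0}b_{i,j}x^iy^j$. Then for all non-negative integers $i,j$, \[b_{i,j}=(-1)^{rk(M)+i+j}\sum_{F\in\mathcal{F}(M)}\left(\sum_{F'\in\mathcal{F}(M/F)}\mu(\emptyset,F')\binom{rk(M)-rk(F\cup F')}{i}\right)\left(\sum_{A\subseteq F}(-1)^{|A|}\binom{|A|-rk(A)}{j}m(A)\right),\] where $\mu$ denotes the Möbius function of the lattice of flats $\mathcal{F}(M/F)$.
   Context: A matroid $(X,rk)$ is a finite set with rank function $rk:2^X\to\mathbb{Z}_{\ge0}$ satisfying $rk(A)\le|A|$, monotonicity and submodularity; $rk(M)=rk(X)$; loopless means no $e$ with $rk(\{e\})=0$. A multiplicity matroid $\mathcal{M}=(X,rk,m)$ is a matroid $(X,rk)$ together with an arbitrary function $m:2^X\to\mathbb{Z}_{>0}$. Its multiplicity Tutte polynomial is $\mathfrak{M}_{\mathcal{M}}(x,y)=\sum_{A\subseteq X}m(A)(x-1)^{rk(X)-rk(A)}(y-1)^{|A|-rk(A)}$. A flat is a set $F$ with $\{e:rk(F\cup\{e\})=rk(F)\}=F$; $\mathcal{F}(N)$ is the lattice of flats of a matroid $N$ ordered by inclusion. For $F\subseteq X$, the contraction $M/F$ is the matroid on $X\setminus F$ with rank $rk_{M/F}(A)=rk(A\cup F)-rk(F)$. The Möbius function $\mu$ of a finite poset satisfies $\sum_{x\le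 y\le z}\mu(x,y)=\delta(x,z)$ for $x\le z$ and $\mu(x,z)=0$ otherwise. -}

module Defs where

open import Data.Nat as ℕ using (ℕ; zero; suc; _∸_; _<_; _≤_)
open import Data.Nat.Combinatorics using (_C_)
open import Data.Integer as ℤ using (ℤ; +_; -1ℤ; _^_; 0ℤ; 1ℤ)
open import Data.Bool using (Bool; true; false; _∧_; _∨_; not; if_then_else_)
open import Data.Bool.Properties as BoolP using ()
open import Data.Fin using (Fin)
open import Data.Fin.Subset using (Subset; _∪_; _∩_; _⊆_; ∣_∣; ⁅_⁆; ⊤; ∁; inside; outside)
open import Data.Fin.Subset.Properties using (_⊆?_; _∈?_)
open import Data.Vec using ([]; _∷_)
open import Data.Vec.Properties using (≡-dec)
open import Data.List using (List; []; _∷_; map; _++_; filter; foldr; allFin)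
open import Relation.Nullary.Decidable using (⌊_⌋)
open import Relation.Binary.PropositionalEquality using (_≡_)

-- Finite ground set X = Fin n; subsets of X are 'Subset n'.

allSubsets : (n : ℕ) → List (Subset n)
allSubsets zero    = [] ∷ []
allSubsets (suc n) = map (outside ∷_) (allSubsets n) ++ map (inside ∷_) (allSubsets n)

_⊆ᵇ_ : ∀ {n} → Subset n → Subset n → Bool
A ⊆ᵇ B = ⌊ A ⊆? B ⌋

_≡ˢ_ : ∀ {n} → Subset n → Subset n → Bool
A ≡ˢ B = ⌊ ≡-dec BoolP._≟_ A B ⌋

sumℤ : List ℤ → ℤ
sumℤ = foldr ℤ._+_ 0ℤ

Σ[_∣_]_ : (n : ℕ) → (Subset n → Bool) → (Subset n → ℤ) → ℤ
Σ[ n ∣ p ] f = sumℤ (map f (filter (λ A → Relation.Nullary.Decidable.Core.T? (p A)) (allSubsets n)))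
  where import Relation.Nullary.Decidable.Core

record IsMatroid {n : ℕ} (rk : Subset n → ℕ) : Set where
  field
    rk-≤-card : ∀ A → rk A ≤ ∣ A ∣
    rk-mono   : ∀ A B → A ⊆ B → rk A ≤ rk B
    rk-submod : ∀ A B → rk (A ∪ B) ℕ.+ rk (A ∩ B) ≤ rk A ℕ.+ rk B

Loopless : {n : ℕ} → (Subset n → ℕ) → Set
Loopless rk = ∀ e → 0 < rk ⁅ e ⁆

rkM : {n : ℕ} → (Subset n → ℕ) → ℕ
rkM rk = rk ⊤

-- rank function of the contraction M/F (on ground set X ∖ F),
-- written on subsets of X:  rk_{M/F}(A) = rk(A ∪ F) − rk(F)
rkContr : {n : ℕ} → (Subset n → ℕ) → Subset n → Subset n → ℕ
rkContr rk F A = rk (A ∪ F) ∸ rk F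

-- G is a flat of the matroid with ground set S and rank function r:
-- G ⊆ S and {e ∈ S : r(G ∪ {e}) = r(G)} = G
isFlatIn : {n : ℕ} → Subset n → (Subset n → ℕ) → Subset n → Bool
isFlatIn {n} S r G =
  (G ⊆ᵇ S) ∧
  foldr _∧_ true (map (λ e → not ⌊ e ∈? S ⌋ ∨
             ⌊ BoolP._≟_ ⌊ r (G ∪ ⁅ e ⁆) ℕ.≟ r G ⌋ ⌊ e ∈? G ⌋ ⌋)
      (allFin n))

isFlat : {n : ℕ} → (Subset n → ℕ) → Subset n → Bool
isFlat rk = isFlatIn ⊤ rk

isFlatContr : {n : ℕ} → (Subset n → ℕ) → Subset n → Subset n → Bool
isFlatContr rk F = isFlatIn (∁ F) (rkContr rk F)

δ : {n : ℕ} → Subset n → Subset n → ℤ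
δ x z = if x ≡ˢ z then 1ℤ else 0ℤ

record IsMöbius {n : ℕ} (P : Subset n → Bool) (μ : Subset n → Subset n → ℤ) : Set where
  field
    möbius-sum  : ∀ x z → P x ≡ true → P z ≡ true → x ⊆ z →
                  Σ[ n ∣ (λ y → P y ∧ (x ⊆ᵇ y) ∧ (y ⊆ᵇ z)) ] (λ y → μ x y) ≡ δ x z
    möbius-zero : ∀ x z → P x ≡ true → P z ≡ true → (x ⊆ᵇ z) ≡ false → μ x z ≡ 0ℤ

-- Polynomials: univariate as coefficient lists (constant term first),
-- bivariate as coefficient functions (i , j) ↦ coefficient of x^i y^j.

Poly : Set
Poly = List ℤ

_+ₚ_ : Poly → Poly → Poly
[]      +ₚ q       = q
(a ∷ p) +ₚ []      = a ∷ p
(a ∷ p) +ₚ (b ∷ q) = (a ℤ.+ b) ∷ (p +ₚ q)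

_*ₚ_ : Poly → Poly → Poly
[]      *ₚ q = []
(a ∷ p) *ₚ q = map (a ℤ.*_) q +ₚ (0ℤ ∷ (p *ₚ q))

_^ₚ_ : Poly → ℕ → Poly
p ^ₚ zero  = 1ℤ ∷ []
p ^ₚ suc k = p *ₚ (p ^ₚ k)

coeff : Poly → ℕ → ℤ
coeff []      _       = 0ℤ
coeff (a ∷ p) zero    = a
coeff (a ∷ p) (suc i) = coeff p i

t-1 : Poly
t-1 = -1ℤ ∷ 1ℤ ∷ []

Poly₂ : Set
Poly₂ = ℕ → ℕ → ℤ

ΣPoly₂ : (n : ℕ) → (Subset n → Poly₂) → Poly₂
ΣPoly₂ n f i j = Σ[ n ∣ (λ _ → true) ] (λ A → f A i j)

mono₂ : ℤ → Poly → Poly → Poly₂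
mono₂ c p q i j = c ℤ.* coeff p i ℤ.* coeff q j

multTutte : (n : ℕ) → (Subset n → ℕ) → (Subset n → ℕ) → Poly₂
multTutte n rk m = ΣPoly₂ n (λ A →
  mono₂ (+ m A) (t-1 ^ₚ (rkM rk ∸ rk A)) (t-1 ^ₚ (∣ A ∣ ∸ rk A)))

sgn : ℕ → ℤ
sgn k = -1ℤ ^ k

-- Reading off coefficients, the coefficient of xⁱ yʲ in the summand of A is
-- (−1)^(r+i+j) · (−1)^∣A∣ C(∣A∣ − rk A, j) m(A) · C(r − rk A, i), where r = rk M.
-- Exchanging the sums over F and A ⊆ F, it remains to show that, for every A,
-- the sum over the flats F ⊇ A of g(F) = Σ_{F′ ∈ 𝓕(M/F)} μ(∅, F′) C(r − rk(F ∪ F′), i)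
-- is C(r − rk A, i). As F′ ↦ F ∪ F′ identifies the flats of M/F with the flats
-- of M above F, g(F) = Σ_{G ⊇ F} μ(F, G) C(r − rk G, i) for the Möbius function
-- of the lattice of flats, and Möbius inversion over the flats above the closure
-- of A yields C(r − rk(cl A), i) = C(r − rk A, i). Inversion needs the right-handed
-- identity Σ_{x ≤ y ≤ z} μ(y, z) = δ(x, z), which follows from the given
-- left-handed one.

module Submission where

open import Defs
open import Data.Nat using (ℕ; _∸_; _<_) renaming (_+_ to _+ℕ_)
open import Data.Nat.Combinatorics using (_C_)
open import Data.Integer using (ℤ; +_; _*_)
open import Data.Bool using (_∧_; true)
open import Data.Fin.Subset using (Subset; _∪_; ∣_∣; ⊥)
open import Relation.Binary.PropositionalEquality using (_≡_)

open import Data.Nat as ℕ using (zero; suc; _≤_)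
import Data.Nat.Properties as ℕP
open import Data.Nat.Combinatorics using (nCk+nC[k+1]≡[n+1]C[k+1])
open import Data.Nat.Induction using (<-wellFounded)
open import Data.Integer as ℤ using (0ℤ; 1ℤ; -1ℤ; _+_; _-_)
import Data.Integer.Properties as ℤP
open import Data.Integer.Tactic.RingSolver using (solve-∀)
open import Data.Bool using (Bool; false; if_then_else_; not; _∨_)
open import Data.Bool.Properties using () renaming (_≟_ to _≟ᵇ_)
open import Data.Bool.ListAction using (all)
open import Data.Fin using (Fin)
open import Data.Fin.Subset using (_∈_; _⊆_; _∩_; ∁; ⁅_⁆; ⊤; ⋃; inside; outside)
open import Data.Fin.Subset.Properties
open import Data.List using (List; []; _∷_; _++_; map; filter; allFin)
import Data.List.Membership.Propositional as List
open import Data.List.Membership.Propositional.Properties using (∈-allFin; ∈-filter⁺; ∈-filter⁻)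
open import Data.List.Relation.Unary.Any using (here; there)
open import Data.Vec using (_∷_; tail) renaming ([] to []ᵛ)
import Data.Vec.Properties as Vec
open import Data.Product using (_×_; _,_; proj₁; proj₂)
open import Data.Sum using (inj₁; inj₂; [_,_])
open import Data.Empty using (⊥-elim)
open import Function using (_∘_)
open import Induction.WellFounded using (Acc; acc)
open import Relation.Nullary using (¬_; Dec; yes; no; contradiction)
open import Relation.Nullary.Decidable using (⌊_⌋; T?)
open import Relation.Binary.PropositionalEquality
  using (_≢_; refl; sym; trans; cong; cong₂; subst; module ≡-Reasoning)

module _ {P : Set} where

  isYes-true : (p? : Dec P) → P → ⌊ p? ⌋ ≡ true
  isYes-true (yes _) _ = refl
  isYes-true (no ¬p) p = contradiction p ¬p

  isYes-false : (p? : Dec P) → ¬ P → ⌊ p? ⌋ ≡ false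
  isYes-false (yes p) ¬p = contradiction p ¬p
  isYes-false (no _)  _  = refl

  isYes-sound : (p? : Dec P) → ⌊ p? ⌋ ≡ true → P
  isYes-sound (yes p) _ = p

bool-ext : {a b : Bool} → (a ≡ true → b ≡ true) → (b ≡ true → a ≡ true) → a ≡ b
bool-ext {true}          a⇒b _   = sym (a⇒b refl)
bool-ext {false} {true}  _   b⇒a = b⇒a refl
bool-ext {false} {false} _   _   = refl

∧-intro : {a b : Bool} → a ≡ true → b ≡ true → a ∧ b ≡ true
∧-intro refl refl = refl

∧-elim : {a b : Bool} → a ∧ b ≡ true → a ≡ true × b ≡ true
∧-elim {true} b≡true = refl , b≡true

module _ {n : ℕ} {A B : Subset n} where

  ⊆ᵇ-sound : A ⊆ᵇ B ≡ true → A ⊆ B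
  ⊆ᵇ-sound = isYes-sound (A ⊆? B)

  ⊆ᵇ-complete : A ⊆ B → A ⊆ᵇ B ≡ true
  ⊆ᵇ-complete = isYes-true (A ⊆? B)

  ≡ˢ-sound : A ≡ˢ B ≡ true → A ≡ B
  ≡ˢ-sound = isYes-sound (Vec.≡-dec _≟ᵇ_ A B)

  ≡ˢ-complete : A ≡ B → A ≡ˢ B ≡ true
  ≡ˢ-complete = isYes-true (Vec.≡-dec _≟ᵇ_ A B)

  δ-≢ : A ≢ B → δ A B ≡ 0ℤ
  δ-≢ A≢B rewrite isYes-false (Vec.≡-dec _≟ᵇ_ A B) A≢B = refl

δ-refl : ∀ {n} (A : Subset n) → δ A A ≡ 1ℤ
δ-refl A rewrite ≡ˢ-complete {A = A} refl = refl

δ-sym : ∀ {n} (A B : Subset n) → δ A B ≡ δ B A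
δ-sym A B = by-cases (Vec.≡-dec _≟ᵇ_ A B)
  where
  by-cases : Dec (A ≡ B) → δ A B ≡ δ B A
  by-cases (yes A≡B) = subst (λ X → δ A X ≡ δ X A) A≡B refl
  by-cases (no A≢B)  = trans (δ-≢ A≢B) (sym (δ-≢ (A≢B ∘ sym)))

-- Finite sums

infixr 5 [_]*_

[_]*_ : Bool → ℤ → ℤ
[ b ]* x = if b then x else 0ℤ

[]*-∧ : ∀ a b x → [ a ∧ b ]* x ≡ [ a ]* [ b ]* x
[]*-∧ true  _ _ = refl
[]*-∧ false _ _ = refl

[]*-*ˡ : ∀ b x y → [ b ]* (x * y) ≡ x * ([ b ]* y)
[]*-*ˡ true  _ _ = refl
[]*-*ˡ false x _ = sym (ℤP.*-zeroʳ x)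

[]*-*ʳ : ∀ b x y → [ b ]* (x * y) ≡ ([ b ]* x) * y
[]*-*ʳ true  _ _ = refl
[]*-*ʳ false _ y = sym (ℤP.*-zeroˡ y)

[]*-true : ∀ {b} x → b ≡ true → [ b ]* x ≡ x
[]*-true _ refl = refl

[]*-cong : ∀ b {x y} → (b ≡ true → x ≡ y) → [ b ]* x ≡ [ b ]* y
[]*-cong true  x≡y = x≡y refl
[]*-cong false _   = refl

[]*-false : ∀ {b} x → b ≡ false → [ b ]* x ≡ 0ℤ
[]*-false _ refl = refl

sumL : {A : Set} → List A → (A → ℤ) → ℤ
sumL xs f = sumℤ (map f xs)

sumS : (n : ℕ) → (Subset n → ℤ) → ℤ
sumS n = sumL (allSubsets n)

module _ {A : Set} where

  sumL-cong : ∀ (xs : List A) {f g} → (∀ x → f x ≡ g x) → sumL xs f ≡ sumL xs g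
  sumL-cong []       _   = refl
  sumL-cong (x ∷ xs) f≗g = cong₂ _+_ (f≗g x) (sumL-cong xs f≗g)

  sumL-zero : ∀ (xs : List A) {f} → (∀ x → f x ≡ 0ℤ) → sumL xs f ≡ 0ℤ
  sumL-zero []       _  = refl
  sumL-zero (x ∷ xs) f≗0 = cong₂ _+_ (f≗0 x) (sumL-zero xs f≗0)

  sumL-+ : ∀ (xs : List A) f g → sumL xs (λ x → f x + g x) ≡ sumL xs f + sumL xs g
  sumL-+ []       _ _ = refl
  sumL-+ (x ∷ xs) f g = trans (cong (_+_ (f x + g x)) (sumL-+ xs f g)) (shuffle (f x) (g x) _ _)
    where
    shuffle : ∀ a b c d → a + b + (c + d) ≡ a + c + (b + d)
    shuffle = solve-∀

  sumL-- : ∀ (xs : List A) f g → sumL xs (λ x → f x - g x) ≡ sumL xs f - sumL xs g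
  sumL-- []       _ _ = refl
  sumL-- (x ∷ xs) f g = trans (cong (_+_ (f x - g x)) (sumL-- xs f g)) (shuffle (f x) (g x) _ _)
    where
    shuffle : ∀ a b c d → a - b + (c - d) ≡ a + c - (b + d)
    shuffle = solve-∀

  sumL-*ˡ : ∀ (xs : List A) c f → sumL xs (λ x → c * f x) ≡ c * sumL xs f
  sumL-*ˡ []       c _ = sym (ℤP.*-zeroʳ c)
  sumL-*ˡ (x ∷ xs) c f =
    trans (cong (_+_ (c * f x)) (sumL-*ˡ xs c f)) (sym (ℤP.*-distribˡ-+ c (f x) _))

  sumL-*ʳ : ∀ (xs : List A) c f → sumL xs (λ x → f x * c) ≡ sumL xs f * c
  sumL-*ʳ xs c f = begin
    sumL xs (λ x → f x * c)  ≡⟨ sumL-cong xs (λ x → ℤP.*-comm (f x) c) ⟩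
    sumL xs (λ x → c * f x)  ≡⟨ sumL-*ˡ xs c f ⟩
    c * sumL xs f            ≡⟨ ℤP.*-comm c _ ⟩
    sumL xs f * c            ∎
    where open ≡-Reasoning

  []*-sumL : ∀ b (xs : List A) f → [ b ]* sumL xs f ≡ sumL xs (λ x → [ b ]* f x)
  []*-sumL true  _  _ = refl
  []*-sumL false xs _ = sym (sumL-zero xs (λ _ → refl))

  sumL-++ : ∀ (xs ys : List A) f → sumL (xs ++ ys) f ≡ sumL xs f + sumL ys f
  sumL-++ []       _  _ = sym (ℤP.+-identityˡ _)
  sumL-++ (x ∷ xs) ys f = trans (cong (_+_ (f x)) (sumL-++ xs ys f)) (sym (ℤP.+-assoc (f x) _ _))

  sumL-map : ∀ {B : Set} (g : B → A) (xs : List B) f → sumL (map g xs) f ≡ sumL xs (f ∘ g)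
  sumL-map g []       _ = refl
  sumL-map g (x ∷ xs) f = cong (_+_ (f (g x))) (sumL-map g xs f)

  sumL-filter : ∀ (xs : List A) (p : A → Bool) f →
    sumℤ (map f (filter (λ x → T? (p x)) xs)) ≡ sumL xs (λ x → [ p x ]* f x)
  sumL-filter []       _ _ = refl
  sumL-filter (x ∷ xs) p f with p x
  ... | true  = cong (_+_ (f x)) (sumL-filter xs p f)
  ... | false = trans (sumL-filter xs p f) (sym (ℤP.+-identityˡ _))

sumL-swap : ∀ {A B : Set} (xs : List A) (ys : List B) (f : A → B → ℤ) →
  sumL xs (λ x → sumL ys (f x)) ≡ sumL ys (λ y → sumL xs (λ x → f x y))
sumL-swap []       ys _ = sym (sumL-zero ys (λ _ → refl))
sumL-swap (x ∷ xs) ys f =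
  trans (cong (_+_ (sumL ys (f x))) (sumL-swap xs ys f)) (sym (sumL-+ ys (f x) _))

sumL-interchange : ∀ {A B : Set} (xs : List A) (ys : List B)
  (p : A → Bool) (r : A → B → Bool) (q : B → Bool) (s : B → A → Bool) (f : A → B → ℤ) →
  (∀ x y → p x ∧ r x y ≡ q y ∧ s y x) →
  sumL xs (λ x → [ p x ]* sumL ys (λ y → [ r x y ]* f x y)) ≡
  sumL ys (λ y → [ q y ]* sumL xs (λ x → [ s y x ]* f x y))
sumL-interchange xs ys p r q s f conditions = begin
  sumL xs (λ x → [ p x ]* sumL ys (λ y → [ r x y ]* f x y))
    ≡⟨ sumL-cong xs (λ x → []*-sumL (p x) ys _) ⟩
  sumL xs (λ x → sumL ys (λ y → [ p x ]* [ r x y ]* f x y))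
    ≡⟨ sumL-swap xs ys _ ⟩
  sumL ys (λ y → sumL xs (λ x → [ p x ]* [ r x y ]* f x y))
    ≡⟨ sumL-cong ys (λ y → sumL-cong xs (λ x → begin
         [ p x ]* [ r x y ]* f x y  ≡⟨ sym ([]*-∧ (p x) _ _) ⟩
         [ p x ∧ r x y ]* f x y     ≡⟨ cong ([_]* f x y) (conditions x y) ⟩
         [ q y ∧ s y x ]* f x y     ≡⟨ []*-∧ (q y) _ _ ⟩
         [ q y ]* [ s y x ]* f x y  ∎)) ⟩
  sumL ys (λ y → sumL xs (λ x → [ q y ]* [ s y x ]* f x y))
    ≡⟨ sumL-cong ys (λ y → sym ([]*-sumL (q y) xs _)) ⟩
  sumL ys (λ y → [ q y ]* sumL xs (λ x → [ s y x ]* f x y)) ∎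
  where open ≡-Reasoning

sumS-suc : ∀ n (f : Subset (suc n) → ℤ) →
  sumS (suc n) f ≡ sumS n (λ B → f (outside ∷ B)) + sumS n (λ B → f (inside ∷ B))
sumS-suc n f = trans (sumL-++ (map (outside ∷_) (allSubsets n)) _ f)
  (cong₂ _+_ (sumL-map (outside ∷_) (allSubsets n) f) (sumL-map (inside ∷_) (allSubsets n) f))

sumS-single : ∀ {n} (x : Subset n) (f : Subset n → ℤ) →
  (∀ y → y ≢ x → f y ≡ 0ℤ) → sumS n f ≡ f x
sumS-single {zero}  []ᵛ           _ _   = ℤP.+-identityʳ _
sumS-single {suc n} (outside ∷ x) f f≗0 = begin
  sumS (suc n) f                                        ≡⟨ sumS-suc n f ⟩
  sumS n (λ y → f (outside ∷ y)) + sumS n (λ y → f (inside ∷ y))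
    ≡⟨ cong₂ _+_ (sumS-single x _ (λ y y≢x → f≗0 _ (y≢x ∘ cong tail)))
                 (sumL-zero (allSubsets n) (λ y → f≗0 _ (λ ()))) ⟩
  f (outside ∷ x) + 0ℤ                                  ≡⟨ ℤP.+-identityʳ _ ⟩
  f (outside ∷ x)                                       ∎
  where open ≡-Reasoning
sumS-single {suc n} (inside ∷ x)  f f≗0 = begin
  sumS (suc n) f                                        ≡⟨ sumS-suc n f ⟩
  sumS n (λ y → f (outside ∷ y)) + sumS n (λ y → f (inside ∷ y))
    ≡⟨ cong₂ _+_ (sumL-zero (allSubsets n) (λ y → f≗0 _ (λ ())))
                 (sumS-single x _ (λ y y≢x → f≗0 _ (y≢x ∘ cong tail))) ⟩
  0ℤ + f (inside ∷ x)                                   ≡⟨ ℤP.+-identityˡ _ ⟩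
  f (inside ∷ x)                                        ∎
  where open ≡-Reasoning

δ-* : ∀ {n} (x y : Subset n) v → δ x y * v ≡ [ x ≡ˢ y ]* v
δ-* x y v with x ≡ˢ y
... | true  = ℤP.*-identityˡ v
... | false = ℤP.*-zeroˡ v

sumS-[≡ˢ] : ∀ {n} (x : Subset n) (f : Subset n → ℤ) → sumS n (λ y → [ x ≡ˢ y ]* f y) ≡ f x
sumS-[≡ˢ] x f = trans (sumS-single x _ off-x) (cong ([_]* f x) (≡ˢ-complete {A = x} refl))
  where
  off-x : ∀ y → y ≢ x → [ x ≡ˢ y ]* f y ≡ 0ℤ
  off-x y y≢x = []*-false (f y) (isYes-false (Vec.≡-dec _≟ᵇ_ x y) (y≢x ∘ sym))

sumS-δ : ∀ {n} (x : Subset n) (f : Subset n → ℤ) → sumS n (λ y → δ x y * f y) ≡ f x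
sumS-δ {n} x f = trans (sumL-cong (allSubsets n) (λ y → δ-* x y (f y))) (sumS-[≡ˢ] x f)

sumS-determines-point : ∀ {n} (x : Subset n) (f g : Subset n → ℤ) → (∀ y → y ≢ x → f y ≡ g y) →
  sumS n f ≡ sumS n g → f x ≡ g x
sumS-determines-point {n} x f g f≗g sums≡ = ℤP.i-j≡0⇒i≡j (f x) (g x) (begin
  f x - g x                        ≡⟨ sumS-single x (λ y → f y - g y) off-x ⟨
  sumS n (λ y → f y - g y)         ≡⟨ sumL-- (allSubsets n) f g ⟩
  sumS n f - sumS n g              ≡⟨ cong (_- sumS n g) sums≡ ⟩
  sumS n g - sumS n g              ≡⟨ ℤP.+-inverseʳ (sumS n g) ⟩
  0ℤ                               ∎)
  where
  open ≡-Reasoning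
  off-x : ∀ y → y ≢ x → f y - g y ≡ 0ℤ
  off-x y y≢x = trans (cong (_- g y) (f≗g y y≢x)) (ℤP.+-inverseʳ (g y))

Σ[]-as-sumS : ∀ n p f → Σ[ n ∣ p ] f ≡ sumS n (λ A → [ p A ]* f A)
Σ[]-as-sumS n = sumL-filter (allSubsets n)

sumS-reindex : ∀ {n} (p q : Subset n → Bool) (to from : Subset n → Subset n) →
  (∀ y → p y ≡ true → q (to y) ≡ true) → (∀ y → p y ≡ true → from (to y) ≡ y) →
  (∀ z → q z ≡ true → p (from z) ≡ true) → (∀ z → q z ≡ true → to (from z) ≡ z) →
  ∀ f → sumS n (λ y → [ p y ]* f y) ≡ sumS n (λ z → [ q z ]* f (from z))
sumS-reindex {n} p q to from to∈q from∘to∈p from∈p to∘from f = begin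
  sumS n (λ y → [ p y ]* f y)
    ≡⟨ sumL-cong (allSubsets n) (λ y → cong ([ p y ]*_) (sumS-[≡ˢ] (to y) (λ _ → f y))) ⟨
  sumS n (λ y → [ p y ]* sumS n (λ z → [ to y ≡ˢ z ]* f y))
    ≡⟨ sumL-interchange (allSubsets n) (allSubsets n)
         p (λ y z → to y ≡ˢ z) q (λ z y → from z ≡ˢ y) (λ y _ → f y) graph ⟩
  sumS n (λ z → [ q z ]* sumS n (λ y → [ from z ≡ˢ y ]* f y))
    ≡⟨ sumL-cong (allSubsets n) (λ z → cong ([ q z ]*_) (sumS-[≡ˢ] (from z) f)) ⟩
  sumS n (λ z → [ q z ]* f (from z)) ∎
  where
  open ≡-Reasoning
  graph : ∀ y z → p y ∧ (to y ≡ˢ z) ≡ q z ∧ (from z ≡ˢ y)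
  graph y z = bool-ext
    (λ h → let (py , to-y≡z) = ∧-elim h ; eq = ≡ˢ-sound to-y≡z in
      ∧-intro (subst (λ w → q w ≡ true) eq (to∈q y py))
              (≡ˢ-complete (trans (cong from (sym eq)) (from∘to∈p y py))))
    (λ h → let (qz , from-z≡y) = ∧-elim h ; eq = ≡ˢ-sound from-z≡y in
      ∧-intro (subst (λ w → p w ≡ true) eq (from∈p z qz))
              (≡ˢ-complete (trans (cong to (sym eq)) (to∘from z qz))))

Σ[]-*-Σ[⊆] : ∀ n (P : Subset n → Bool) (g w : Subset n → ℤ) →
  Σ[ n ∣ P ] (λ F → g F * Σ[ n ∣ (_⊆ᵇ F) ] w) ≡
  sumS n (λ A → sumS n (λ F → [ P F ∧ (A ⊆ᵇ F) ]* g F) * w A)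
Σ[]-*-Σ[⊆] n P g w = begin
  Σ[ n ∣ P ] (λ F → g F * Σ[ n ∣ (_⊆ᵇ F) ] w)
    ≡⟨ Σ[]-as-sumS n P _ ⟩
  sumS n (λ F → [ P F ]* (g F * Σ[ n ∣ (_⊆ᵇ F) ] w))
    ≡⟨ sumL-cong (allSubsets n) (λ F → cong ([ P F ]*_) (begin
         g F * Σ[ n ∣ (_⊆ᵇ F) ] w                        ≡⟨ cong (g F *_) (Σ[]-as-sumS n (_⊆ᵇ F) w) ⟩
         g F * sumS n (λ A → [ A ⊆ᵇ F ]* w A)            ≡⟨ sumL-*ˡ (allSubsets n) (g F) _ ⟨
         sumS n (λ A → g F * ([ A ⊆ᵇ F ]* w A))          ≡⟨ sumL-cong (allSubsets n) (λ A → []*-*ˡ (A ⊆ᵇ F) (g F) (w A)) ⟨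
         sumS n (λ A → [ A ⊆ᵇ F ]* (g F * w A))          ∎)) ⟩
  sumS n (λ F → [ P F ]* sumS n (λ A → [ A ⊆ᵇ F ]* (g F * w A)))
    ≡⟨ sumL-interchange (allSubsets n) (allSubsets n) P (λ F A → A ⊆ᵇ F) (λ _ → true)
         (λ A F → P F ∧ (A ⊆ᵇ F)) (λ F A → g F * w A) (λ _ _ → refl) ⟩
  sumS n (λ A → sumS n (λ F → [ P F ∧ (A ⊆ᵇ F) ]* (g F * w A)))
    ≡⟨ sumL-cong (allSubsets n) (λ A → trans
         (sumL-cong (allSubsets n) (λ F → []*-*ʳ (P F ∧ (A ⊆ᵇ F)) (g F) (w A)))
         (sumL-*ʳ (allSubsets n) (w A) _)) ⟩
  sumS n (λ A → sumS n (λ F → [ P F ∧ (A ⊆ᵇ F) ]* g F) * w A) ∎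
  where open ≡-Reasoning

-- Coefficients of (t - 1)ᵏ

coeff-+ₚ : ∀ p q i → coeff (p +ₚ q) i ≡ coeff p i + coeff q i
coeff-+ₚ []      _       _       = sym (ℤP.+-identityˡ _)
coeff-+ₚ (a ∷ p) []      _       = sym (ℤP.+-identityʳ _)
coeff-+ₚ (a ∷ p) (b ∷ q) zero    = refl
coeff-+ₚ (a ∷ p) (b ∷ q) (suc i) = coeff-+ₚ p q i

coeff-map-* : ∀ a p i → coeff (map (a *_) p) i ≡ a * coeff p i
coeff-map-* a []      _       = sym (ℤP.*-zeroʳ a)
coeff-map-* a (x ∷ p) zero    = refl
coeff-map-* a (x ∷ p) (suc i) = coeff-map-* a p i

coeff-[0] : ∀ i → coeff (0ℤ ∷ []) i ≡ 0ℤ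
coeff-[0] zero    = refl
coeff-[0] (suc i) = refl

coeff-[t-1]*ₚ : ∀ p i → coeff (t-1 *ₚ p) i ≡ coeff (0ℤ ∷ p) i - coeff p i
coeff-[t-1]*ₚ p i = begin
  coeff (t-1 *ₚ p) i
    ≡⟨ coeff-+ₚ (map (-1ℤ *_) p) _ i ⟩
  coeff (map (-1ℤ *_) p) i + coeff (0ℤ ∷ (map (1ℤ *_) p +ₚ (0ℤ ∷ []))) i
    ≡⟨ cong₂ _+_ (coeff-map-* -1ℤ p i) (shifted i) ⟩
  -1ℤ * coeff p i + coeff (0ℤ ∷ p) i
    ≡⟨ rearrange (coeff p i) _ ⟩
  coeff (0ℤ ∷ p) i - coeff p i ∎
  where
  open ≡-Reasoning
  rearrange : ∀ c d → -1ℤ * c + d ≡ d - c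
  rearrange = solve-∀
  shifted : ∀ i → coeff (0ℤ ∷ (map (1ℤ *_) p +ₚ (0ℤ ∷ []))) i ≡ coeff (0ℤ ∷ p) i
  shifted zero    = refl
  shifted (suc i) = begin
    coeff (map (1ℤ *_) p +ₚ (0ℤ ∷ [])) i   ≡⟨ coeff-+ₚ (map (1ℤ *_) p) _ i ⟩
    coeff (map (1ℤ *_) p) i + coeff (0ℤ ∷ []) i
      ≡⟨ cong₂ _+_ (trans (coeff-map-* 1ℤ p i) (ℤP.*-identityˡ _)) (coeff-[0] i) ⟩
    coeff p i + 0ℤ                          ≡⟨ ℤP.+-identityʳ _ ⟩
    coeff p i                               ∎

coeff-[t-1]^ : ∀ k i → coeff (t-1 ^ₚ k) i ≡ sgn (k +ℕ i) * + (k C i)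
coeff-[t-1]^ zero    zero    = refl
coeff-[t-1]^ zero    (suc i) = sym (ℤP.*-zeroʳ (sgn (suc i)))
coeff-[t-1]^ (suc k) zero    = begin
  coeff (t-1 *ₚ (t-1 ^ₚ k)) 0           ≡⟨ coeff-[t-1]*ₚ (t-1 ^ₚ k) 0 ⟩
  0ℤ - coeff (t-1 ^ₚ k) 0               ≡⟨ cong (_-_ 0ℤ) (coeff-[t-1]^ k 0) ⟩
  0ℤ - sgn (k +ℕ 0) * + (k C 0)         ≡⟨ negate (sgn (k +ℕ 0)) (+ (k C 0)) ⟩
  -1ℤ * sgn (k +ℕ 0) * + (k C 0)        ∎
  where
  open ≡-Reasoning
  negate : ∀ s c → 0ℤ - s * c ≡ -1ℤ * s * c
  negate = solve-∀
coeff-[t-1]^ (suc k) (suc i) = begin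
  coeff (t-1 *ₚ (t-1 ^ₚ k)) (suc i)                      ≡⟨ coeff-[t-1]*ₚ (t-1 ^ₚ k) (suc i) ⟩
  coeff (t-1 ^ₚ k) i - coeff (t-1 ^ₚ k) (suc i)
    ≡⟨ cong₂ _-_ (coeff-[t-1]^ k i) (coeff-[t-1]^ k (suc i)) ⟩
  sgn (k +ℕ i) * + (k C i) - sgn (k +ℕ suc i) * + (k C suc i)
    ≡⟨ cong (λ m → sgn (k +ℕ i) * + (k C i) - sgn m * + (k C suc i)) (ℕP.+-suc k i) ⟩
  sgn (k +ℕ i) * + (k C i) - -1ℤ * sgn (k +ℕ i) * + (k C suc i)
    ≡⟨ pascal-signed (sgn (k +ℕ i)) (+ (k C i)) (+ (k C suc i)) ⟩
  -1ℤ * (-1ℤ * sgn (k +ℕ i)) * (+ (k C i) + + (k C suc i))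
    ≡⟨ cong₂ (λ m c → -1ℤ * sgn m * c) (sym (ℕP.+-suc k i))
             (trans (sym (ℤP.pos-+ (k C i) (k C suc i))) (cong +_ (nCk+nC[k+1]≡[n+1]C[k+1] k i))) ⟩
  -1ℤ * sgn (k +ℕ suc i) * + (suc k C suc i) ∎
  where
  open ≡-Reasoning
  pascal-signed : ∀ s a b → s * a - -1ℤ * s * b ≡ -1ℤ * (-1ℤ * s) * (a + b)
  pascal-signed = solve-∀

sgn-+ : ∀ p q → sgn (p +ℕ q) ≡ sgn p * sgn q
sgn-+ = ℤP.^-distribˡ-+-* -1ℤ

sgn-square : ∀ k → sgn k * sgn k ≡ 1ℤ
sgn-square zero    = refl
sgn-square (suc k) = trans (square-neg (sgn k)) (sgn-square k)
  where
  square-neg : ∀ s → -1ℤ * s * (-1ℤ * s) ≡ s * s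
  square-neg = solve-∀

sgn-shift : ∀ a b k i j → sgn (a +ℕ i) * sgn (b +ℕ j) ≡ sgn (a +ℕ k +ℕ i +ℕ j) * sgn (b +ℕ k)
sgn-shift a b k i j
  rewrite sgn-+ a i | sgn-+ b j | sgn-+ (a +ℕ k +ℕ i) j | sgn-+ (a +ℕ k) i
        | sgn-+ a k | sgn-+ b k = begin
  sgn a * sgn i * (sgn b * sgn j)
    ≡⟨ ℤP.*-identityʳ _ ⟨
  sgn a * sgn i * (sgn b * sgn j) * 1ℤ
    ≡⟨ cong (_*_ (sgn a * sgn i * (sgn b * sgn j))) (sgn-square k) ⟨
  sgn a * sgn i * (sgn b * sgn j) * (sgn k * sgn k)
    ≡⟨ regroup (sgn a) (sgn b) (sgn k) (sgn i) (sgn j) ⟩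
  sgn a * sgn k * sgn i * sgn j * (sgn b * sgn k) ∎
  where
  open ≡-Reasoning
  regroup : ∀ sa sb sk si sj → sa * si * (sb * sj) * (sk * sk) ≡ sa * sk * si * sj * (sb * sk)
  regroup = solve-∀

coeff-[t-1]^-product : ∀ {r c k} (M : ℤ) i j → k ≤ r → k ≤ c →
  M * coeff (t-1 ^ₚ (r ∸ k)) i * coeff (t-1 ^ₚ (c ∸ k)) j ≡
  sgn (r +ℕ i +ℕ j) * (+ ((r ∸ k) C i) * (sgn c * + ((c ∸ k) C j) * M))
coeff-[t-1]^-product {r} {c} {k} M i j k≤r k≤c = begin
  M * coeff (t-1 ^ₚ a) i * coeff (t-1 ^ₚ b) j
    ≡⟨ cong₂ (λ x y → M * x * y) (coeff-[t-1]^ a i) (coeff-[t-1]^ b j) ⟩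
  M * (sgn (a +ℕ i) * + (a C i)) * (sgn (b +ℕ j) * + (b C j))
    ≡⟨ regroup M (+ (a C i)) (+ (b C j)) (sgn (a +ℕ i)) (sgn (b +ℕ j)) ⟩
  sgn (a +ℕ i) * sgn (b +ℕ j) * (+ (a C i) * + (b C j) * M)
    ≡⟨ cong (_* (+ (a C i) * + (b C j) * M)) signs ⟩
  sgn (r +ℕ i +ℕ j) * sgn c * (+ (a C i) * + (b C j) * M)
    ≡⟨ regroup′ (sgn (r +ℕ i +ℕ j)) (sgn c) (+ (a C i)) (+ (b C j)) M ⟩
  sgn (r +ℕ i +ℕ j) * (+ (a C i) * (sgn c * + (b C j) * M)) ∎
  where
  open ≡-Reasoning
  a = r ∸ k
  b = c ∸ k
  signs : sgn (a +ℕ i) * sgn (b +ℕ j) ≡ sgn (r +ℕ i +ℕ j) * sgn c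
  signs = trans (sgn-shift a b k i j)
    (cong₂ (λ r′ c′ → sgn (r′ +ℕ i +ℕ j) * sgn c′) (ℕP.m∸n+n≡m k≤r) (ℕP.m∸n+n≡m k≤c))
  regroup : ∀ M x y s t → M * (s * x) * (t * y) ≡ s * t * (x * y * M)
  regroup = solve-∀
  regroup′ : ∀ s t x y M → s * t * (x * y * M) ≡ s * (x * (t * y * M))
  regroup′ = solve-∀

module _ {n : ℕ} where

  ∪-least : {p q r : Subset n} → p ⊆ r → q ⊆ r → p ∪ q ⊆ r
  ∪-least {p} {q} p⊆r q⊆r x∈p∪q = [ p⊆r , q⊆r ] (x∈p∪q⁻ p q x∈p∪q)

  ∩-greatest : {p q r : Subset n} → r ⊆ p → r ⊆ q → r ⊆ p ∩ q
  ∩-greatest r⊆p r⊆q x∈r = x∈p∩q⁺ (r⊆p x∈r , r⊆q x∈r)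

  ∪-⁅⁆-absorb : {p : Subset n} {x : Fin n} → x ∈ p → p ∪ ⁅ x ⁆ ≡ p
  ∪-⁅⁆-absorb {x = x} x∈p =
    ⊆-antisym (∪-least ⊆-refl (λ y∈⁅x⁆ → subst (_∈ _) (sym (x∈⁅y⁆⇒x≡y x y∈⁅x⁆)) x∈p)) (p⊆p∪q _)

  ∪-─-inverse : {p q : Subset n} → p ⊆ q → p ∪ (q ∩ ∁ p) ≡ q
  ∪-─-inverse {p} {q} p⊆q = ⊆-antisym (∪-least p⊆q (p∩q⊆p q (∁ p))) q⊆p∪[q─p]
    where
    q⊆p∪[q─p] : q ⊆ p ∪ (q ∩ ∁ p)
    q⊆p∪[q─p] {x} x∈q with x ∈? p
    ... | yes x∈p = p⊆p∪q _ x∈p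
    ... | no  x∉p = q⊆p∪q p _ (x∈p∩q⁺ (x∈q , x∉p⇒x∈∁p x∉p))

  ─-∪-inverse : {p q : Subset n} → q ⊆ ∁ p → (p ∪ q) ∩ ∁ p ≡ q
  ─-∪-inverse {p} {q} q⊆∁p = ⊆-antisym [p∪q]─p⊆q (∩-greatest (q⊆p∪q p q) q⊆∁p)
    where
    [p∪q]─p⊆q : (p ∪ q) ∩ ∁ p ⊆ q
    [p∪q]─p⊆q x∈ with x∈p∩q⁻ (p ∪ q) (∁ p) x∈
    ... | x∈p∪q , x∈∁p = [ (λ x∈p → contradiction x∈p (x∈∁p⇒x∉p x∈∁p)) , (λ x∈q → x∈q) ]
                           (x∈p∪q⁻ p q x∈p∪q)

  ─-mono-⊆ : {p q r : Subset n} → p ⊆ q → p ⊆ r → q ∩ ∁ p ⊆ r ∩ ∁ p → q ⊆ r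
  ─-mono-⊆ {p} {q} {r} p⊆q p⊆r q─p⊆r─p {x} x∈q with x ∈? p
  ... | yes x∈p = p⊆r x∈p
  ... | no  x∉p = proj₁ (x∈p∩q⁻ r _ (q─p⊆r─p (x∈p∩q⁺ (x∈q , x∉p⇒x∈∁p x∉p))))

  ⊆-strict-∣∣ : {p q : Subset n} → p ⊆ q → q ≢ p → ∣ p ∣ < ∣ q ∣
  ⊆-strict-∣∣ {p} {q} p⊆q q≢p with p ⊂? q
  ... | yes p⊂q = p⊂q⇒∣p∣<∣q∣ p⊂q
  ... | no  p⊄q = contradiction (⊆-antisym q⊆p p⊆q) q≢p
    where
    q⊆p : q ⊆ p
    q⊆p {x} x∈q with x ∈? p
    ... | yes x∈p = x∈p
    ... | no  x∉p = ⊥-elim (p⊄q (p⊆q , x , x∈q , x∉p))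

  ⋃-singletons⁺ : {x : Fin n} {xs : List (Fin n)} → x List.∈ xs → x ∈ ⋃ (map ⁅_⁆ xs)
  ⋃-singletons⁺ {x} (here refl) = x∈p∪q⁺ (inj₁ (x∈⁅x⁆ x))
  ⋃-singletons⁺     (there x∈xs) = x∈p∪q⁺ (inj₂ (⋃-singletons⁺ x∈xs))

  ⋃-singletons⁻ : {x : Fin n} (xs : List (Fin n)) → x ∈ ⋃ (map ⁅_⁆ xs) → x List.∈ xs
  ⋃-singletons⁻ []       x∈⊥ = contradiction x∈⊥ ∉⊥
  ⋃-singletons⁻ (y ∷ ys) x∈⋃ with x∈p∪q⁻ ⁅ y ⁆ _ x∈⋃
  ... | inj₁ x∈⁅y⁆ = here (x∈⁅y⁆⇒x≡y y x∈⁅y⁆)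
  ... | inj₂ x∈ys  = there (⋃-singletons⁻ ys x∈ys)

IsFlatIn : ∀ {n} → Subset n → (Subset n → ℕ) → Subset n → Set
IsFlatIn S r G = G ⊆ S × (∀ e → e ∈ S → r (G ∪ ⁅ e ⁆) ≡ r G → e ∈ G)

module _ {A : Set} (t : A → Bool) where

  all-sound : ∀ xs → all t xs ≡ true → ∀ {x} → x List.∈ xs → t x ≡ true
  all-sound (y ∷ ys) all≡true (here refl)  = proj₁ (∧-elim all≡true)
  all-sound (y ∷ ys) all≡true (there x∈ys) = all-sound ys (proj₂ (∧-elim all≡true)) x∈ys

  all-complete : ∀ xs → (∀ x → t x ≡ true) → all t xs ≡ true
  all-complete []       _      = refl
  all-complete (y ∷ ys) t≡true = ∧-intro (t≡true y) (all-complete ys t≡true)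

module _ {n : ℕ} (S : Subset n) (r : Subset n → ℕ) (G : Subset n) where

  private
    closed-at : Fin n → Bool
    closed-at e = not ⌊ e ∈? S ⌋ ∨ ⌊ ⌊ r (G ∪ ⁅ e ⁆) ℕ.≟ r G ⌋ ≟ᵇ ⌊ e ∈? G ⌋ ⌋

    closed-at-sound : ∀ e → closed-at e ≡ true → e ∈ S → r (G ∪ ⁅ e ⁆) ≡ r G → e ∈ G
    closed-at-sound e closed e∈S same-rank
      with e ∈? S | r (G ∪ ⁅ e ⁆) ℕ.≟ r G | e ∈? G
    ... | no e∉S | _              | _     = contradiction e∈S e∉S
    ... | yes _  | no rank≢       | _     = contradiction same-rank rank≢
    ... | yes _  | yes _          | yes e∈G = e∈G

    closed-at-complete : (∀ e → e ∈ S → r (G ∪ ⁅ e ⁆) ≡ r G → e ∈ G) → ∀ e → closed-at e ≡ true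
    closed-at-complete closed e with e ∈? S | r (G ∪ ⁅ e ⁆) ℕ.≟ r G | e ∈? G
    ... | no _    | _          | _       = refl
    ... | yes _   | yes _      | yes _   = refl
    ... | yes e∈S | yes same   | no e∉G  = contradiction (closed e e∈S same) e∉G
    ... | yes _   | no rank≢   | yes e∈G = contradiction (cong r (∪-⁅⁆-absorb e∈G)) rank≢
    ... | yes _   | no _       | no _    = refl

  isFlatIn-sound : isFlatIn S r G ≡ true → IsFlatIn S r G
  isFlatIn-sound flat =
    ⊆ᵇ-sound (proj₁ (∧-elim flat)) ,
    λ e → closed-at-sound e (all-sound closed-at (allFin n) (proj₂ (∧-elim flat)) (∈-allFin e))

  isFlatIn-complete : IsFlatIn S r G → isFlatIn S r G ≡ true
  isFlatIn-complete (G⊆S , closed) =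
    ∧-intro (⊆ᵇ-complete G⊆S) (all-complete closed-at (allFin n) (closed-at-complete closed))

-- Closure and contraction in a matroid

∸-cancelʳ-≡ : ∀ {m n o} → o ≤ m → o ≤ n → m ∸ o ≡ n ∸ o → m ≡ n
∸-cancelʳ-≡ {m} {n} {o} o≤m o≤n eq =
  trans (sym (ℕP.m∸n+n≡m o≤m)) (trans (cong (ℕ._+ o) eq) (ℕP.m∸n+n≡m o≤n))

module Matroid {n : ℕ} {rk : Subset n → ℕ} (isM : IsMatroid rk) where

  open IsMatroid isM

  rk-monotone : ∀ {A B} → A ⊆ B → rk A ≤ rk B
  rk-monotone = rk-mono _ _

  rk-absorb : ∀ {A B e} → A ⊆ B → rk (A ∪ ⁅ e ⁆) ≡ rk A → rk (B ∪ ⁅ e ⁆) ≡ rk B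
  rk-absorb {A} {B} {e} A⊆B spans = ℕP.≤-antisym rk[B∪e]≤rk[B] (rk-monotone (p⊆p∪q _))
    where
    open ℕP.≤-Reasoning
    C = A ∪ ⁅ e ⁆
    rk[B∪C]≤rk[B] : rk (B ∪ C) ≤ rk B
    rk[B∪C]≤rk[B] = ℕP.+-cancelʳ-≤ (rk (B ∩ C)) _ _ (begin
      rk (B ∪ C) ℕ.+ rk (B ∩ C) ≤⟨ rk-submod B C ⟩
      rk B ℕ.+ rk C             ≡⟨ cong (rk B ℕ.+_) spans ⟩
      rk B ℕ.+ rk A             ≤⟨ ℕP.+-monoʳ-≤ (rk B) (rk-monotone (∩-greatest A⊆B (p⊆p∪q _))) ⟩
      rk B ℕ.+ rk (B ∩ C)       ∎)
    rk[B∪e]≤rk[B] : rk (B ∪ ⁅ e ⁆) ≤ rk B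
    rk[B∪e]≤rk[B] = begin
      rk (B ∪ ⁅ e ⁆) ≤⟨ rk-monotone (∪-least (p⊆p∪q C) (⊆-trans (q⊆p∪q A _) (q⊆p∪q B C))) ⟩
      rk (B ∪ C)     ≤⟨ rk[B∪C]≤rk[B] ⟩
      rk B           ∎

  rk-∪-spanned : ∀ A es → (∀ {e} → e List.∈ es → rk (A ∪ ⁅ e ⁆) ≡ rk A) →
                 rk (A ∪ ⋃ (map ⁅_⁆ es)) ≡ rk A
  rk-∪-spanned A []       _       = cong rk (∪-identityʳ A)
  rk-∪-spanned A (e ∷ es) spanned = begin
    rk (A ∪ (⁅ e ⁆ ∪ U))  ≡⟨ cong rk (trans (cong (A ∪_) (∪-comm ⁅ e ⁆ U)) (sym (∪-assoc A U ⁅ e ⁆))) ⟩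
    rk ((A ∪ U) ∪ ⁅ e ⁆)  ≡⟨ rk-absorb (p⊆p∪q U) (spanned (here refl)) ⟩
    rk (A ∪ U)            ≡⟨ rk-∪-spanned A es (spanned ∘ there) ⟩
    rk A                  ∎
    where
    open ≡-Reasoning
    U = ⋃ (map ⁅_⁆ es)

  spans? : ∀ A e → Dec (rk (A ∪ ⁅ e ⁆) ≡ rk A)
  spans? A e = rk (A ∪ ⁅ e ⁆) ℕ.≟ rk A

  spanned : Subset n → List (Fin n)
  spanned A = filter (spans? A) (allFin n)

  cl : Subset n → Subset n
  cl A = ⋃ (map ⁅_⁆ (spanned A))

  ∈-cl⁻ : ∀ {A e} → e ∈ cl A → rk (A ∪ ⁅ e ⁆) ≡ rk A
  ∈-cl⁻ {A} e∈cl = proj₂ (∈-filter⁻ (spans? A) {xs = allFin n} (⋃-singletons⁻ (spanned A) e∈cl))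

  ∈-cl⁺ : ∀ {A e} → rk (A ∪ ⁅ e ⁆) ≡ rk A → e ∈ cl A
  ∈-cl⁺ {A} {e} spans = ⋃-singletons⁺ (∈-filter⁺ (spans? A) (∈-allFin e) spans)

  ⊆-cl : ∀ A → A ⊆ cl A
  ⊆-cl A e∈A = ∈-cl⁺ (cong rk (∪-⁅⁆-absorb e∈A))

  rk-cl : ∀ A → rk (cl A) ≡ rk A
  rk-cl A = ℕP.≤-antisym
    (ℕP.≤-trans (rk-monotone (q⊆p∪q A _)) (ℕP.≤-reflexive (rk-∪-spanned A (spanned A) (λ e∈ → proj₂ (∈-filter⁻ (spans? A) {xs = allFin n} e∈)))))
    (rk-monotone (⊆-cl A))

  cl-isFlat : ∀ A → IsFlatIn ⊤ rk (cl A)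
  cl-isFlat A = ⊆⊤ , λ e _ same → ∈-cl⁺ (ℕP.≤-antisym (begin
    rk (A ∪ ⁅ e ⁆)     ≤⟨ rk-monotone (∪-least (⊆-trans (⊆-cl A) (p⊆p∪q _)) (q⊆p∪q _ _)) ⟩
    rk (cl A ∪ ⁅ e ⁆)  ≡⟨ same ⟩
    rk (cl A)          ≡⟨ rk-cl A ⟩
    rk A               ∎) (rk-monotone (p⊆p∪q _)))
    where open ℕP.≤-Reasoning

  cl-least : ∀ {A F} → IsFlatIn ⊤ rk F → A ⊆ F → cl A ⊆ F
  cl-least (_ , closed) A⊆F {e} e∈cl = closed e ∈⊤ (rk-absorb A⊆F (∈-cl⁻ e∈cl))

  rkContr-∪ : ∀ F y → rkContr rk F y ≡ rk (F ∪ y) ∸ rk F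
  rkContr-∪ F y = cong (λ X → rk X ∸ rk F) (∪-comm y F)

  rkContr-∪-⁅⁆ : ∀ F y e → rkContr rk F (y ∪ ⁅ e ⁆) ≡ rk ((F ∪ y) ∪ ⁅ e ⁆) ∸ rk F
  rkContr-∪-⁅⁆ F y e = trans (rkContr-∪ F (y ∪ ⁅ e ⁆)) (cong (λ X → rk X ∸ rk F) (sym (∪-assoc F y ⁅ e ⁆)))

  contraction-isFlat⁺ : ∀ F y → y ⊆ ∁ F → IsFlatIn ⊤ rk (F ∪ y) → IsFlatIn (∁ F) (rkContr rk F) y
  contraction-isFlat⁺ F y y⊆∁F (_ , closed) = y⊆∁F , λ e e∉F same →
    [ (λ e∈F → contradiction e∈F (x∈∁p⇒x∉p e∉F)) , (λ e∈y → e∈y) ]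
      (x∈p∪q⁻ F y (closed e ∈⊤ (∸-cancelʳ-≡ (rk-monotone (⊆-trans (p⊆p∪q y) (p⊆p∪q _))) (rk-monotone (p⊆p∪q y))
        (trans (sym (rkContr-∪-⁅⁆ F y e)) (trans same (rkContr-∪ F y))))))

  contraction-isFlat⁻ : ∀ F y → IsFlatIn (∁ F) (rkContr rk F) y → IsFlatIn ⊤ rk (F ∪ y)
  contraction-isFlat⁻ F y (_ , closed) = ⊆⊤ , closed′
    where
    closed′ : ∀ e → e ∈ ⊤ → rk ((F ∪ y) ∪ ⁅ e ⁆) ≡ rk (F ∪ y) → e ∈ F ∪ y
    closed′ e _ same with e ∈? F
    ... | yes e∈F = p⊆p∪q y e∈F
    ... | no  e∉F = q⊆p∪q F y (closed e (x∉p⇒x∈∁p e∉F)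
      (trans (rkContr-∪-⁅⁆ F y e) (trans (cong (_∸ rk F) same) (sym (rkContr-∪ F y)))))

-- Möbius functions of families of subsets ordered by inclusion

module Interval {n : ℕ} (P : Subset n → Bool) where

  above : Subset n → Subset n → Bool
  above x y = P y ∧ (x ⊆ᵇ y)

  interval : Subset n → Subset n → Subset n → Bool
  interval x z y = P y ∧ (x ⊆ᵇ y) ∧ (y ⊆ᵇ z)

  above-intro : ∀ {x y} → P y ≡ true → x ⊆ y → above x y ≡ true
  above-intro Py x⊆y = ∧-intro Py (⊆ᵇ-complete x⊆y)

  above-elim : ∀ {x y} → above x y ≡ true → P y ≡ true × x ⊆ y
  above-elim h = let (Py , x⊆y) = ∧-elim h in Py , ⊆ᵇ-sound x⊆y

  interval-intro : ∀ {x y z} → P y ≡ true → x ⊆ y → y ⊆ z → interval x z y ≡ true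
  interval-intro Py x⊆y y⊆z = ∧-intro Py (∧-intro (⊆ᵇ-complete x⊆y) (⊆ᵇ-complete y⊆z))

  interval-elim : ∀ {x y z} → interval x z y ≡ true → P y ≡ true × x ⊆ y × y ⊆ z
  interval-elim h = let (Py , rest) = ∧-elim h ; (x⊆y , y⊆z) = ∧-elim rest in
    Py , ⊆ᵇ-sound x⊆y , ⊆ᵇ-sound y⊆z

  interval-nested : ∀ x y z w → interval x z y ∧ interval y z w ≡ interval x z w ∧ interval x w y
  interval-nested x y z w = bool-ext
    (λ h → let (y∈ , w∈) = ∧-elim h ; (Py , x⊆y , y⊆z) = interval-elim y∈
               (Pw , y⊆w , w⊆z) = interval-elim w∈ in
      ∧-intro (interval-intro Pw (⊆-trans x⊆y y⊆w) w⊆z) (interval-intro Py x⊆y y⊆w))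
    (λ h → let (w∈ , y∈) = ∧-elim h ; (Pw , x⊆w , w⊆z) = interval-elim w∈
               (Py , x⊆y , y⊆w) = interval-elim y∈ in
      ∧-intro (interval-intro Py x⊆y (⊆-trans y⊆w w⊆z)) (interval-intro Pw y⊆w w⊆z))

  LeftMöbius : (Subset n → Subset n → ℤ) → Set
  LeftMöbius μ = ∀ x z → P x ≡ true → P z ≡ true → x ⊆ z →
                 sumS n (λ y → [ interval x z y ]* μ x y) ≡ δ x z

module Möbius {n : ℕ} (P : Subset n → Bool) (μ : Subset n → Subset n → ℤ)
              (left : Interval.LeftMöbius P μ) where

  open Interval P

  μ-diagonal : ∀ x → P x ≡ true → μ x x ≡ 1ℤ
  μ-diagonal x Px = begin
    μ x x                                    ≡⟨ []*-true (μ x x) (interval-intro Px ⊆-refl ⊆-refl) ⟨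
    [ interval x x x ]* μ x x                ≡⟨ sumS-single x _ off-x ⟨
    sumS n (λ y → [ interval x x y ]* μ x y) ≡⟨ left x x Px Px ⊆-refl ⟩
    δ x x                                    ≡⟨ δ-refl x ⟩
    1ℤ                                       ∎
    where
    open ≡-Reasoning
    off-x : ∀ y → y ≢ x → [ interval x x y ]* μ x y ≡ 0ℤ
    off-x y y≢x with interval x x y in y∈
    ... | false = refl
    ... | true  = let (_ , x⊆y , y⊆x) = interval-elim y∈ in contradiction (⊆-antisym y⊆x x⊆y) y≢x

  rightSum : Subset n → Subset n → ℤ
  rightSum x z = sumS n (λ y → [ interval x z y ]* μ y z)

  private
    left-* : ∀ x z → P x ≡ true → P z ≡ true → x ⊆ z → ∀ c →
             sumS n (λ y → [ interval x z y ]* (μ x y * c)) ≡ δ x z * c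
    left-* x z Px Pz x⊆z c = begin
      sumS n (λ y → [ interval x z y ]* (μ x y * c))   ≡⟨ sumL-cong (allSubsets n) (λ y → []*-*ʳ _ (μ x y) c) ⟩
      sumS n (λ y → ([ interval x z y ]* μ x y) * c)   ≡⟨ sumL-*ʳ (allSubsets n) c _ ⟩
      sumS n (λ y → [ interval x z y ]* μ x y) * c     ≡⟨ cong (_* c) (left x z Px Pz x⊆z) ⟩
      δ x z * c                                        ∎
      where open ≡-Reasoning

    μ-*-rightSum : ∀ x z → P x ≡ true → x ⊆ z →
                   sumS n (λ y → [ interval x z y ]* (μ x y * rightSum y z)) ≡ μ x z
    μ-*-rightSum x z Px x⊆z = begin
      sumS n (λ y → [ interval x z y ]* (μ x y * rightSum y z))
        ≡⟨ sumL-cong (allSubsets n) (λ y → cong ([ interval x z y ]*_) (begin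
             μ x y * rightSum y z
               ≡⟨ sumL-*ˡ (allSubsets n) (μ x y) _ ⟨
             sumS n (λ w → μ x y * ([ interval y z w ]* μ w z))
               ≡⟨ sumL-cong (allSubsets n) (λ w → []*-*ˡ (interval y z w) (μ x y) (μ w z)) ⟨
             sumS n (λ w → [ interval y z w ]* (μ x y * μ w z)) ∎)) ⟩
      sumS n (λ y → [ interval x z y ]* sumS n (λ w → [ interval y z w ]* (μ x y * μ w z)))
        ≡⟨ sumL-interchange (allSubsets n) (allSubsets n) (interval x z) (λ y → interval y z)
             (interval x z) (interval x) (λ y w → μ x y * μ w z) (λ y w → interval-nested x y z w) ⟩
      sumS n (λ w → [ interval x z w ]* sumS n (λ y → [ interval x w y ]* (μ x y * μ w z)))
        ≡⟨ sumL-cong (allSubsets n) (λ w → []*-cong (interval x z w) (λ w∈ →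
             let (Pw , x⊆w , _) = interval-elim w∈ in left-* x w Px Pw x⊆w (μ w z))) ⟩
      sumS n (λ w → [ interval x z w ]* (δ x w * μ w z))
        ≡⟨ sumL-cong (allSubsets n) (λ w → []*-*ˡ (interval x z w) (δ x w) (μ w z)) ⟩
      sumS n (λ w → δ x w * ([ interval x z w ]* μ w z))
        ≡⟨ sumS-δ x _ ⟩
      [ interval x z x ]* μ x z
        ≡⟨ []*-true (μ x z) (interval-intro Px ⊆-refl x⊆z) ⟩
      μ x z ∎
      where open ≡-Reasoning

    μ-*-δ : ∀ x z → P z ≡ true → x ⊆ z →
            sumS n (λ y → [ interval x z y ]* (μ x y * δ y z)) ≡ μ x z
    μ-*-δ x z Pz x⊆z = begin
      sumS n (λ y → [ interval x z y ]* (μ x y * δ y z))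
        ≡⟨ sumL-cong (allSubsets n) (λ y → begin
             [ interval x z y ]* (μ x y * δ y z) ≡⟨ cong ([ interval x z y ]*_) (ℤP.*-comm (μ x y) (δ y z)) ⟩
             [ interval x z y ]* (δ y z * μ x y) ≡⟨ []*-*ˡ (interval x z y) (δ y z) (μ x y) ⟩
             δ y z * ([ interval x z y ]* μ x y) ≡⟨ cong (_* ([ interval x z y ]* μ x y)) (δ-sym y z) ⟩
             δ z y * ([ interval x z y ]* μ x y) ∎) ⟩
      sumS n (λ y → δ z y * ([ interval x z y ]* μ x y))
        ≡⟨ sumS-δ z _ ⟩
      [ interval x z z ]* μ x z
        ≡⟨ []*-true (μ x z) (interval-intro Pz x⊆z ⊆-refl) ⟩
      μ x z ∎
      where open ≡-Reasoning

  -- μ ⋆ ζ = δ implies ζ ⋆ μ = δ by descending induction on x: the two sums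
  -- μ ⋆ (ζ ⋆ μ) = μ = μ ⋆ δ over [x, z] agree off x by induction, and μ x x = 1.
  right : ∀ x z → P x ≡ true → P z ≡ true → x ⊆ z → rightSum x z ≡ δ x z
  right x z = go x (<-wellFounded (n ∸ ∣ x ∣))
    where
    go : ∀ x → Acc _<_ (n ∸ ∣ x ∣) → P x ≡ true → P z ≡ true → x ⊆ z → rightSum x z ≡ δ x z
    go x (acc smaller) Px Pz x⊆z = begin
      rightSum x z                  ≡⟨ ℤP.*-identityˡ _ ⟨
      1ℤ * rightSum x z             ≡⟨ cong (_* rightSum x z) (μ-diagonal x Px) ⟨
      μ x x * rightSum x z          ≡⟨ []*-true _ x∈[x,z] ⟨
      [ interval x z x ]* (μ x x * rightSum x z)
        ≡⟨ sumS-determines-point x _ _ agree-off-x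
             (trans (μ-*-rightSum x z Px x⊆z) (sym (μ-*-δ x z Pz x⊆z))) ⟩
      [ interval x z x ]* (μ x x * δ x z)
                                    ≡⟨ []*-true _ x∈[x,z] ⟩
      μ x x * δ x z                 ≡⟨ cong (_* δ x z) (μ-diagonal x Px) ⟩
      1ℤ * δ x z                    ≡⟨ ℤP.*-identityˡ _ ⟩
      δ x z                         ∎
      where
      open ≡-Reasoning
      x∈[x,z] : interval x z x ≡ true
      x∈[x,z] = interval-intro Px ⊆-refl x⊆z
      agree-off-x : ∀ y → y ≢ x →
        [ interval x z y ]* (μ x y * rightSum y z) ≡ [ interval x z y ]* (μ x y * δ y z)
      agree-off-x y y≢x = []*-cong (interval x z y) (λ y∈ →
        let (Py , x⊆y , y⊆z) = interval-elim y∈ in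
        cong (μ x y *_) (go y (smaller (ℕP.∸-monoʳ-< (⊆-strict-∣∣ x⊆y y≢x) (∣p∣≤n y))) Py Pz y⊆z))

  inversion : ∀ A c → P c ≡ true → A ⊆ c → (∀ F → P F ≡ true → A ⊆ F → c ⊆ F) →
    ∀ (h : Subset n → ℤ) →
    sumS n (λ F → [ above A F ]* sumS n (λ G → [ above F G ]* (μ F G * h G))) ≡ h c
  inversion A c Pc A⊆c c-least h = begin
    sumS n (λ F → [ above A F ]* sumS n (λ G → [ above F G ]* (μ F G * h G)))
      ≡⟨ sumL-interchange (allSubsets n) (allSubsets n) (above A) above (above c) (interval c)
           (λ F G → μ F G * h G) conditions ⟩
    sumS n (λ G → [ above c G ]* sumS n (λ F → [ interval c G F ]* (μ F G * h G)))
      ≡⟨ sumL-cong (allSubsets n) (λ G → []*-cong (above c G) (λ G∈ →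
           let (PG , c⊆G) = above-elim G∈ in begin
           sumS n (λ F → [ interval c G F ]* (μ F G * h G))
             ≡⟨ sumL-cong (allSubsets n) (λ F → []*-*ʳ (interval c G F) (μ F G) (h G)) ⟩
           sumS n (λ F → ([ interval c G F ]* μ F G) * h G)
             ≡⟨ sumL-*ʳ (allSubsets n) (h G) _ ⟩
           rightSum c G * h G
             ≡⟨ cong (_* h G) (right c G Pc PG c⊆G) ⟩
           δ c G * h G ∎)) ⟩
    sumS n (λ G → [ above c G ]* (δ c G * h G))
      ≡⟨ sumL-cong (allSubsets n) (λ G → []*-*ˡ (above c G) (δ c G) (h G)) ⟩
    sumS n (λ G → δ c G * ([ above c G ]* h G))
      ≡⟨ sumS-δ c _ ⟩
    [ above c c ]* h c
      ≡⟨ []*-true (h c) (above-intro Pc ⊆-refl) ⟩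
    h c ∎
    where
    open ≡-Reasoning
    conditions : ∀ F G → above A F ∧ above F G ≡ above c G ∧ interval c G F
    conditions F G = bool-ext
      (λ h → let (F∈ , G∈) = ∧-elim h ; (PF , A⊆F) = above-elim F∈ ; (PG , F⊆G) = above-elim G∈
                 c⊆F = c-least F PF A⊆F in
        ∧-intro (above-intro PG (⊆-trans c⊆F F⊆G)) (interval-intro PF c⊆F F⊆G))
      (λ h → let (G∈ , F∈) = ∧-elim h ; (PG , _) = above-elim G∈ ; (PF , c⊆F , F⊆G) = interval-elim F∈ in
        ∧-intro (above-intro PF (⊆-trans A⊆c c⊆F)) (above-intro PG F⊆G))

-- The lattice of flats

δ-─ : ∀ {n} {F G : Subset n} → F ⊆ G → δ ⊥ (G ∩ ∁ F) ≡ δ F G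
δ-─ {F = F} {G} F⊆G = by-cases (Vec.≡-dec _≟ᵇ_ F G)
  where
  by-cases : Dec (F ≡ G) → δ ⊥ (G ∩ ∁ F) ≡ δ F G
  by-cases (yes F≡G) = trans (cong (δ ⊥) (trans (cong (λ X → G ∩ ∁ X) F≡G) (∩-inverseʳ G)))
                             (trans (δ-refl ⊥) (sym (subst (λ X → δ F X ≡ 1ℤ) F≡G (δ-refl F))))
  by-cases (no F≢G)  = trans (δ-≢ ⊥≢G─F) (sym (δ-≢ F≢G))
    where
    ⊥≢G─F : ⊥ ≢ G ∩ ∁ F
    ⊥≢G─F ⊥≡G─F = F≢G (trans (sym (∪-identityʳ F)) (trans (cong (F ∪_) ⊥≡G─F) (∪-─-inverse F⊆G)))

module Flats {n : ℕ} {rk : Subset n → ℕ} (isM : IsMatroid rk) where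

  open Matroid isM
  open Interval (isFlat rk)

  isFlat-sound : ∀ {G} → isFlat rk G ≡ true → IsFlatIn ⊤ rk G
  isFlat-sound = isFlatIn-sound ⊤ rk _

  isFlat-complete : ∀ {G} → IsFlatIn ⊤ rk G → isFlat rk G ≡ true
  isFlat-complete = isFlatIn-complete ⊤ rk _

  contraction-above : ∀ F G → above F G ≡ true → isFlatContr rk F (G ∩ ∁ F) ≡ true
  contraction-above F G G∈ = let (flatG , F⊆G) = above-elim G∈ in
    isFlatIn-complete (∁ F) (rkContr rk F) _ (contraction-isFlat⁺ F _ (p∩q⊆q G (∁ F))
      (subst (IsFlatIn ⊤ rk) (sym (∪-─-inverse F⊆G)) (isFlat-sound flatG)))

  reindex-contraction : ∀ F (ψ : Subset n → ℤ) →
    sumS n (λ y → [ isFlatContr rk F y ]* ψ y) ≡ sumS n (λ G → [ above F G ]* ψ (G ∩ ∁ F))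
  reindex-contraction F = sumS-reindex (isFlatContr rk F) (above F) (F ∪_) (_∩ ∁ F)
    (λ y y∈ → above-intro (isFlat-complete (contraction-isFlat⁻ F y (flatContr y∈))) (p⊆p∪q y))
    (λ y y∈ → ─-∪-inverse (proj₁ (flatContr y∈)))
    (contraction-above F)
    (λ G G∈ → ∪-─-inverse (proj₂ (above-elim G∈)))
    where
    flatContr : ∀ {y} → isFlatContr rk F y ≡ true → IsFlatIn (∁ F) (rkContr rk F) y
    flatContr = isFlatIn-sound (∁ F) (rkContr rk F) _

  module _ (μ : Subset n → Subset n → Subset n → ℤ)
           (μ-möbius : ∀ F → isFlat rk F ≡ true → IsMöbius (isFlatContr rk F) (μ F)) where

    μ-flats : Subset n → Subset n → ℤ
    μ-flats F G = μ F ⊥ (G ∩ ∁ F)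

    μ-flats-leftMöbius : LeftMöbius μ-flats
    μ-flats-leftMöbius F G flatF flatG F⊆G = begin
      sumS n (λ H → [ interval F G H ]* μ-flats F H)
        ≡⟨ sumL-cong (allSubsets n) restrict ⟩
      sumS n (λ H → [ above F H ]* ψ (H ∩ ∁ F))
        ≡⟨ reindex-contraction F ψ ⟨
      sumS n (λ y → [ isFlatContr rk F y ]* ψ y)
        ≡⟨ sumL-cong (allSubsets n) (λ y → []*-∧ (isFlatContr rk F y) _ _) ⟨
      sumS n (λ y → [ isFlatContr rk F y ∧ (⊥ ⊆ᵇ y) ∧ (y ⊆ᵇ (G ∩ ∁ F)) ]* μ F ⊥ y)
        ≡⟨ Σ[]-as-sumS n _ _ ⟨
      Σ[ n ∣ (λ y → isFlatContr rk F y ∧ (⊥ ⊆ᵇ y) ∧ (y ⊆ᵇ (G ∩ ∁ F))) ] μ F ⊥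
        ≡⟨ IsMöbius.möbius-sum (μ-möbius F flatF) ⊥ (G ∩ ∁ F) ⊥-flat
             (contraction-above F G (above-intro flatG F⊆G)) ⊥⊆ ⟩
      δ ⊥ (G ∩ ∁ F)
        ≡⟨ δ-─ F⊆G ⟩
      δ F G ∎
      where
      open ≡-Reasoning
      ψ : Subset n → ℤ
      ψ y = [ (⊥ ⊆ᵇ y) ∧ (y ⊆ᵇ (G ∩ ∁ F)) ]* μ F ⊥ y
      ⊥-flat : isFlatContr rk F ⊥ ≡ true
      ⊥-flat = isFlatIn-complete (∁ F) (rkContr rk F) ⊥ (contraction-isFlat⁺ F ⊥ ⊥⊆
        (subst (IsFlatIn ⊤ rk) (sym (∪-identityʳ F)) (isFlat-sound flatF)))
      ─-⊆ᵇ : ∀ {H} → F ⊆ H → ((H ∩ ∁ F) ⊆ᵇ (G ∩ ∁ F)) ≡ (H ⊆ᵇ G)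
      ─-⊆ᵇ {H} F⊆H = bool-ext
        (λ h → ⊆ᵇ-complete (─-mono-⊆ F⊆H F⊆G (⊆ᵇ-sound h)))
        (λ h → ⊆ᵇ-complete (∩-greatest (⊆-trans (p∩q⊆p H (∁ F)) (⊆ᵇ-sound h)) (p∩q⊆q H (∁ F))))
      restrict : ∀ H → [ interval F G H ]* μ-flats F H ≡ [ above F H ]* ψ (H ∩ ∁ F)
      restrict H with isFlat rk H | F ⊆? H
      ... | false | _        = refl
      ... | true  | no _     = refl
      ... | true  | yes F⊆H rewrite isYes-true (⊥ ⊆? (H ∩ ∁ F)) ⊥⊆ | ─-⊆ᵇ F⊆H = refl

    möbius-inversion-flats : ∀ (f : ℕ → ℤ) A →
      sumS n (λ F → [ above A F ]* Σ[ n ∣ isFlatContr rk F ] (λ F′ → μ F ⊥ F′ * f (rk (F ∪ F′))))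
        ≡ f (rk A)
    möbius-inversion-flats f A = begin
      sumS n (λ F → [ above A F ]* Σ[ n ∣ isFlatContr rk F ] (λ F′ → μ F ⊥ F′ * f (rk (F ∪ F′))))
        ≡⟨ sumL-cong (allSubsets n) (λ F → cong ([ above A F ]*_) (begin
             Σ[ n ∣ isFlatContr rk F ] (λ F′ → μ F ⊥ F′ * f (rk (F ∪ F′)))
               ≡⟨ Σ[]-as-sumS n _ _ ⟩
             sumS n (λ F′ → [ isFlatContr rk F F′ ]* (μ F ⊥ F′ * f (rk (F ∪ F′))))
               ≡⟨ reindex-contraction F _ ⟩
             sumS n (λ G → [ above F G ]* (μ-flats F G * f (rk (F ∪ (G ∩ ∁ F)))))
               ≡⟨ sumL-cong (allSubsets n) (λ G → []*-cong (above F G) (λ G∈ →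
                    cong (λ X → μ-flats F G * f (rk X)) (∪-─-inverse (proj₂ (above-elim G∈))))) ⟩
             sumS n (λ G → [ above F G ]* (μ-flats F G * f (rk G))) ∎)) ⟩
      sumS n (λ F → [ above A F ]* sumS n (λ G → [ above F G ]* (μ-flats F G * f (rk G))))
        ≡⟨ Möbius.inversion (isFlat rk) μ-flats μ-flats-leftMöbius A (cl A) (isFlat-complete (cl-isFlat A)) (⊆-cl A)
             (λ F flatF A⊆F → cl-least (isFlat-sound flatF) A⊆F) (f ∘ rk) ⟩
      f (rk (cl A))
        ≡⟨ cong f (rk-cl A) ⟩
      f (rk A) ∎
      where open ≡-Reasoning

lemma3p2 : (n : ℕ) (rk : Subset n → ℕ) → IsMatroid rk → Loopless rk →
           (m : Subset n → ℕ) → (∀ A → 0 < m A) →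
           (μ : Subset n → Subset n → Subset n → ℤ) →
           (∀ F → isFlat rk F ≡ true → IsMöbius (isFlatContr rk F) (μ F)) →
           ∀ i j →
           multTutte n rk m i j ≡
             sgn (rkM rk +ℕ i +ℕ j) *
             Σ[ n ∣ isFlat rk ] (λ F →
               Σ[ n ∣ isFlatContr rk F ] (λ F′ →
                 μ F ⊥ F′ * + ((rkM rk ∸ rk (F ∪ F′)) C i))
               *
               Σ[ n ∣ (λ A → A ⊆ᵇ F) ] (λ A →
                 sgn ∣ A ∣ * + ((∣ A ∣ ∸ rk A) C j) * + m A))
lemma3p2 n rk isM _ m _ μ μ-möbius i j = begin
  multTutte n rk m i j
    ≡⟨ Σ[]-as-sumS n _ _ ⟩
  sumS n (λ A → + m A * coeff (t-1 ^ₚ (rkM rk ∸ rk A)) i * coeff (t-1 ^ₚ (∣ A ∣ ∸ rk A)) j)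
    ≡⟨ sumL-cong (allSubsets n) (λ A →
         coeff-[t-1]^-product (+ m A) i j (rk-mono A ⊤ ⊆⊤) (rk-≤-card A)) ⟩
  sumS n (λ A → sgn (rkM rk +ℕ i +ℕ j) * (f (rk A) * w A))
    ≡⟨ sumL-*ˡ (allSubsets n) (sgn (rkM rk +ℕ i +ℕ j)) _ ⟩
  sgn (rkM rk +ℕ i +ℕ j) * sumS n (λ A → f (rk A) * w A)
    ≡⟨ cong (sgn (rkM rk +ℕ i +ℕ j) *_) (sumL-cong (allSubsets n) (λ A →
         cong (_* w A) (möbius-inversion-flats μ μ-möbius f A))) ⟨
  sgn (rkM rk +ℕ i +ℕ j) * sumS n (λ A →
    sumS n (λ F → [ isFlat rk F ∧ (A ⊆ᵇ F) ]* Σ[ n ∣ isFlatContr rk F ] (λ F′ → μ F ⊥ F′ * f (rk (F ∪ F′)))) * w A)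
    ≡⟨ cong (sgn (rkM rk +ℕ i +ℕ j) *_) (Σ[]-*-Σ[⊆] n (isFlat rk) _ w) ⟨
  sgn (rkM rk +ℕ i +ℕ j) * Σ[ n ∣ isFlat rk ] (λ F →
    Σ[ n ∣ isFlatContr rk F ] (λ F′ → μ F ⊥ F′ * f (rk (F ∪ F′))) * Σ[ n ∣ (_⊆ᵇ F) ] w) ∎
  where
  open ≡-Reasoning
  open IsMatroid isM
  open Flats isM
  f : ℕ → ℤ
  f r = + ((rkM rk ∸ r) C i)
  w : Subset n → ℤ
  w A = sgn ∣ A ∣ * + ((∣ A ∣ ∸ rk A) C j) * + m A
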